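{- Let $G$ be a finite simple undirected graph containing a copy $H$ of the 5-gate as an induced subgraph, with $V(G)\setminus V(H)\neq\emptyset$, such that the edges of $G$ having exactly one endpoint in $V(H)$ are exactly five edges (the external edges), one incident to each of the attachment vertices $1,2,9,11,13$ of $H$. Then every Hamiltonian cycle $C$ of $G$ contains exactly two of the external edges of $H$; equivalently, once $C$ enters $H$ it visits every vertex of $H$ before exiting.
   Context: The 5-gate is the simple undirected graph on vertex set $\{1,\dots,13\}$ with the 17 edges $\{1,3\},\{1,8\},\{1,12\},\{2,3\},\{2,5\},\{3,4\},\{4,5\},\{4,6\},\{6,7\},\{7,8\},\{7,10\},\{8,9\},\{9,10\},\{10,13\},\{12,13\},\{11,12\},\{5,11\}$; its attachment vertices are $1,2,9,11,13$. A Hamiltonian cycle is a cycle through every vertex exactly once. -}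

module Defs where

open import Data.Nat using (ℕ; zero; suc; _≤_)
open import Data.Nat.DivMod using (_%_; m%n<n)
open import Data.Fin using (Fin; zero; suc; toℕ; fromℕ<; _≟_)
open import Data.Fin.Patterns

pattern 10F = suc 9F
pattern 11F = suc 10F
pattern 12F = suc 11F
open import Data.List using (List; []; _∷_; length; filter; allFin)
open import Data.Bool.ListAction using (any)
open import Data.List.Membership.Propositional using (_∈_)
open import Data.Bool using (Bool; true; false; _xor_; T; T?)
open import Data.Product using (_×_; _,_; ∃)
open import Data.Sum using (_⊎_)
open import Data.Empty using (⊥)
open import Relation.Nullary using (¬_; does)
open import Relation.Binary.PropositionalEquality using (_≡_; _≢_)
open import Function.Bundles using (_⇔_)
open import Function.Definitions using (Injective; Surjective)
open import Level using (0ℓ)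

record SimpleGraph (n : ℕ) : Set₁ where
  field
    Adj    : Fin n → Fin n → Set
    sym    : ∀ {u v} → Adj u v → Adj v u
    irrefl : ∀ {v} → ¬ Adj v v
open SimpleGraph public

-- The 5-gate on vertices 0..12 (vertex k of the paper is k-1 here).
gateEdges : List (Fin 13 × Fin 13)
gateEdges =
  (0F , 2F) ∷ (0F , 7F) ∷ (0F , 11F) ∷ (1F , 2F) ∷ (1F , 4F) ∷ (2F , 3F) ∷
  (3F , 4F) ∷ (3F , 5F) ∷ (5F , 6F) ∷ (6F , 7F) ∷ (6F , 9F) ∷ (7F , 8F) ∷
  (8F , 9F) ∷ (9F , 12F) ∷ (11F , 12F) ∷ (10F , 11F) ∷ (4F , 10F) ∷ []

GateAdj : Fin 13 → Fin 13 → Set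
GateAdj i j = ((i , j) ∈ gateEdges) ⊎ ((j , i) ∈ gateEdges)

isAttachment : Fin 13 → Bool
isAttachment 0F  = true
isAttachment 1F  = true
isAttachment 8F  = true
isAttachment 10F = true
isAttachment 12F = true
isAttachment _   = false

Outside : ∀ {n} → (Fin 13 → Fin n) → Fin n → Set
Outside f v = ∀ j → f j ≢ v

inImage : ∀ {n} → (Fin 13 → Fin n) → Fin n → Bool
inImage f v = any (λ j → does (f j ≟ v)) (allFin 13)

record GateCopy {n : ℕ} (G : SimpleGraph n) (f : Fin 13 → Fin n) : Set where
  field
    injective  : Injective _≡_ _≡_ f
    induced    : ∀ i j → Adj G (f i) (f j) ⇔ GateAdj i j
    nonempty   : ∃ λ v → Outside f v
    attach     : ∀ i → T (isAttachment i) →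
                   ∃ λ v → Outside f v × Adj G (f i) v ×
                     (∀ w → Outside f w → Adj G (f i) w → w ≡ v)
    nonAttach  : ∀ i → ¬ T (isAttachment i) →
                   ∀ w → Outside f w → ¬ Adj G (f i) w

next : ∀ {n} → Fin n → Fin n
next {suc m} i = fromℕ< (m%n<n (suc (toℕ i)) (suc m))

-- A Hamiltonian cycle: a cyclic ordering c 0, c 1, …, c (n-1) of all
-- vertices, each exactly once, with consecutive vertices (cyclically) adjacent.
-- (n ≥ 3 so that this is a genuine cycle.)
record HamiltonianCycle {n : ℕ} (G : SimpleGraph n) : Set where
  field
    three      : 3 ≤ n
    c          : Fin n → Fin n
    injective  : Injective _≡_ _≡_ c
    surjective : Surjective _≡_ _≡_ c
    adjacent   : ∀ i → Adj G (c i) (c (next i))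
open HamiltonianCycle public
  using (c)

externalEdgesUsed : ∀ {n} {G : SimpleGraph n} →
                    (Fin 13 → Fin n) → HamiltonianCycle G → ℕ
externalEdgesUsed {n} f C =
  length (filter (λ i → T? (inImage f (c C i) xor inImage f (c C (next i)))) (allFin n))

-- Every vertex of the copy H of the gate has two distinct neighbours on the Hamiltonian cycle C.
-- An attachment vertex has a single neighbour outside H and the other vertices have none, so at
-- most one of the two lies outside H, and only at an attachment vertex. Hence the edges of C inside
-- H form a subgraph of the gate with degree 2 everywhere except at attachment vertices, where the
-- degree may be 1, and the edges of C leaving H are exactly the missing degrees. An exhaustive check
-- over the 2^17 edge subsets of the 5-gate shows that such a subgraph has exactly two vertices of
-- degree 1.

module Submission where

open import Defs hiding (sym)
open import Data.Bool using (Bool; true; false; T; _∨_; _∧_; _xor_; if_then_else_)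
open import Data.Bool.Properties using (∨-comm; ∧-conicalˡ; ∧-conicalʳ; T-≡)
open import Data.Empty using (⊥; ⊥-elim)
open import Data.Fin using (Fin; zero; suc; toℕ; fromℕ; inject₁; _≟_)
open import Data.Fin.Patterns
open import Data.Fin.Properties using (all?; any?; toℕ-injective; toℕ-fromℕ<; toℕ-fromℕ; toℕ-inject₁; inject₁ℕ<; toℕ<n)
open import Data.List using (List; []; _∷_; _++_; length; filter; allFin)
open import Data.List.Membership.Propositional using (_∈_)
open import Data.List.Membership.Propositional.Properties using (∈-allFin)
open import Data.List.Relation.Unary.All as All using (All; []; _∷_)
open import Data.List.Relation.Unary.Any as Any using (here; there)
open import Data.List.Relation.Unary.Any.Properties using (any⁺; any⁻)
open import Data.List.Relation.Unary.Unique.Propositional using (Unique; _∷_)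
open import Data.List.Relation.Unary.Unique.Propositional.Properties using (allFin⁺)
open import Data.Nat using (ℕ; zero; suc; _+_; _≤_; _≤ᵇ_; s≤s; s≤s⁻¹)
open import Data.Nat.DivMod using (_%_; n%n≡0; m<n⇒m%n≡m)
open import Data.Nat.Properties using (+-suc; m≤n⇒m<n∨m≡n; m≢1+n+m; <⇒≢; <⇒≤; suc-injective) renaming (_≟_ to _≟ℕ_)
open import Data.Product using (∃; ∃₂; _×_; _,_; proj₁; proj₂)
open import Data.Product.Properties using (≡-dec)
open import Data.Sum using (_⊎_; inj₁; inj₂) renaming (map to map-⊎)
open import Data.Unit using (tt)
open import Data.Vec using (Vec; []; _∷_)
open import Function using (_∘_; _⇔_; mk⇔; Equivalence)
open import Function.Properties.Equivalence using () renaming (sym to ⇔-sym)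
open import Relation.Binary.Definitions using (DecidableEquality)
open import Relation.Binary.PropositionalEquality
open import Relation.Nullary using (Dec; does; ¬_; ¬?; yes; no)
open import Relation.Nullary.Decidable
  using (T?; _×-dec_; _⊎-dec_; _→-dec_; toWitness; does-⇔)

does-sound : ∀ {A : Set} (a? : Dec A) → T (does a?) → A
does-sound (yes a) _ = a

does-complete : ∀ {A : Set} (a? : Dec A) → A → T (does a?)
does-complete (yes _) _ = tt
does-complete (no ¬a) a = ¬a a

allᵇ : ∀ n → (Vec Bool n → Bool) → Bool
allᵇ zero    p = p []
allᵇ (suc n) p = allᵇ n (p ∘ (true ∷_)) ∧ allᵇ n (p ∘ (false ∷_))

allᵇ-sound : ∀ {n} (p : Vec Bool n → Bool) → allᵇ n p ≡ true → ∀ v → p v ≡ true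
allᵇ-sound {zero}  p all [] = all
allᵇ-sound {suc n} p all (true  ∷ v) = allᵇ-sound (p ∘ (true ∷_)) (∧-conicalˡ _ _ all) v
allᵇ-sound {suc n} p all (false ∷ v) = allᵇ-sound (p ∘ (false ∷_)) (∧-conicalʳ _ _ all) v

count : ∀ {A : Set} → (A → Bool) → List A → ℕ
count p []       = 0
count p (x ∷ xs) = if p x then suc (count p xs) else count p xs

module _ {A : Set} where

  count-cong : ∀ {p q : A → Bool} → p ≗ q → ∀ xs → count p xs ≡ count q xs
  count-cong p≗q [] = refl
  count-cong {p} {q} p≗q (x ∷ xs) with p x | q x | p≗q x
  ... | true  | true  | refl = cong suc (count-cong p≗q xs)
  ... | false | false | refl = count-cong p≗q xs

  length-filter : ∀ (p : A → Bool) xs → length (filter (T? ∘ p) xs) ≡ count p xs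
  length-filter p [] = refl
  length-filter p (x ∷ xs) with p x
  ... | true  = cong suc (length-filter p xs)
  ... | false = length-filter p xs

  count-++ : ∀ (p : A → Bool) xs ys → count p (xs ++ ys) ≡ count p xs + count p ys
  count-++ p [] ys = refl
  count-++ p (x ∷ xs) ys with p x
  ... | true  = cong suc (count-++ p xs ys)
  ... | false = count-++ p xs ys

  count-none : ∀ {p : A → Bool} {xs} → All (λ x → ¬ T (p x)) xs → count p xs ≡ 0
  count-none [] = refl
  count-none {p} {x ∷ _} (¬px ∷ ¬ps) with p x | ¬px
  ... | false | _   = count-none ¬ps
  ... | true  | ¬pt = ⊥-elim (¬pt tt)

  count-∨ : ∀ {p q : A → Bool} → (∀ x → T (p x) → T (q x) → ⊥) →
            ∀ xs → count (λ x → p x ∨ q x) xs ≡ count p xs + count q xs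
  count-∨ disjoint [] = refl
  count-∨ {p} {q} disjoint (x ∷ xs) with p x | q x | disjoint x
  ... | true  | true  | ¬both = ⊥-elim (¬both tt tt)
  ... | true  | false | _     = cong suc (count-∨ disjoint xs)
  ... | false | true  | _     = trans (cong suc (count-∨ disjoint xs)) (sym (+-suc _ _))
  ... | false | false | _     = count-∨ disjoint xs

  module _ (_≟ₐ_ : DecidableEquality A) where

    count-≟-unique : ∀ {a xs} → Unique xs → a ∈ xs → count (λ x → does (x ≟ₐ a)) xs ≡ 1
    count-≟-unique {a} (x∉xs ∷ _) (here refl) with a ≟ₐ a
    ... | yes _   = cong suc (count-none (All.map (λ {y} a≢y → a≢y ∘ sym ∘ does-sound (y ≟ₐ a)) x∉xs))
    ... | no a≢a  = ⊥-elim (a≢a refl)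
    count-≟-unique {a} {x ∷ _} (x∉xs ∷ unique) (there a∈xs) with x ≟ₐ a
    ... | yes refl = ⊥-elim (All.lookup x∉xs a∈xs refl)
    ... | no _     = count-≟-unique unique a∈xs

    count-≡2 : ∀ {p : A → Bool} {a b xs} → Unique xs → a ∈ xs → b ∈ xs → a ≢ b →
               (∀ x → T (p x) ⇔ (x ≡ a ⊎ x ≡ b)) → count p xs ≡ 2
    count-≡2 {p} {a} {b} {xs} unique a∈xs b∈xs a≢b p⇔ = begin
      count p xs
        ≡⟨ count-cong (λ x → does-⇔ (p⇔ x) (T? (p x)) ((x ≟ₐ a) ⊎-dec (x ≟ₐ b))) xs ⟩
      count (λ x → does (x ≟ₐ a) ∨ does (x ≟ₐ b)) xs
        ≡⟨ count-∨ (λ x x≡a x≡b → a≢b (trans (sym (does-sound (x ≟ₐ a) x≡a)) (does-sound (x ≟ₐ b) x≡b)))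
                   xs ⟩
      count (λ x → does (x ≟ₐ a)) xs + count (λ x → does (x ≟ₐ b)) xs
        ≡⟨ cong₂ _+_ (count-≟-unique unique a∈xs) (count-≟-unique unique b∈xs) ⟩
      2 ∎
      where open ≡-Reasoning

-- The cyclic order on Fin (suc m)

data LastOrInject₁ : ∀ {m} → Fin (suc m) → Set where
  last   : ∀ {m} → LastOrInject₁ (fromℕ m)
  inject : ∀ {m} (i : Fin m) → LastOrInject₁ (inject₁ i)

lastOrInject₁ : ∀ {m} (i : Fin (suc m)) → LastOrInject₁ i
lastOrInject₁ {zero}  zero    = last
lastOrInject₁ {suc m} zero    = inject zero
lastOrInject₁ {suc m} (suc i) with lastOrInject₁ i
... | last     = last
... | inject j = inject (suc j)

prev : ∀ {m} → Fin (suc m) → Fin (suc m)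
prev {m} zero = fromℕ m
prev (suc i)  = inject₁ i

module _ {m : ℕ} where
  open ≡-Reasoning

  toℕ-next : (i : Fin (suc m)) → toℕ (next i) ≡ suc (toℕ i) % suc m
  toℕ-next i = toℕ-fromℕ< _

  next-fromℕ : next (fromℕ m) ≡ zero
  next-fromℕ = toℕ-injective (begin
    toℕ (next (fromℕ m))        ≡⟨ toℕ-next (fromℕ m) ⟩
    suc (toℕ (fromℕ m)) % suc m ≡⟨ cong (λ t → suc t % suc m) (toℕ-fromℕ m) ⟩
    suc m % suc m               ≡⟨ n%n≡0 (suc m) ⟩
    0                           ∎)

  next-inject₁ : (i : Fin m) → next (inject₁ i) ≡ suc i
  next-inject₁ i = toℕ-injective (begin
    toℕ (next (inject₁ i))        ≡⟨ toℕ-next (inject₁ i) ⟩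
    suc (toℕ (inject₁ i)) % suc m ≡⟨ m<n⇒m%n≡m (s≤s (inject₁ℕ< i)) ⟩
    suc (toℕ (inject₁ i))         ≡⟨ cong suc (toℕ-inject₁ i) ⟩
    suc (toℕ i)                   ∎)

  next-prev : (i : Fin (suc m)) → next (prev i) ≡ i
  next-prev zero    = next-fromℕ
  next-prev (suc i) = next-inject₁ i

  prev-next : (i : Fin (suc m)) → prev (next i) ≡ i
  prev-next i with lastOrInject₁ i
  ... | last     = cong prev next-fromℕ
  ... | inject j = cong prev (next-inject₁ j)

  next≢prev : 2 ≤ m → (i : Fin (suc m)) → next i ≢ prev i
  next≢prev 2≤m zero next≡prev = <⇒≢ 2≤m (begin
    1               ≡⟨ sym (m<n⇒m%n≡m (s≤s (<⇒≤ 2≤m))) ⟩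
    1 % suc m       ≡⟨ sym (toℕ-next zero) ⟩
    toℕ (next zero) ≡⟨ cong toℕ next≡prev ⟩
    toℕ (fromℕ m)   ≡⟨ toℕ-fromℕ m ⟩
    m               ∎)
  next≢prev 2≤m (suc i) next≡prev with m≤n⇒m<n∨m≡n (s≤s (toℕ<n i))
  ... | inj₁ 2+i<1+m = m≢1+n+m (toℕ i) {1} (sym (begin
    suc (suc (toℕ i))         ≡⟨ sym (m<n⇒m%n≡m 2+i<1+m) ⟩
    suc (suc (toℕ i)) % suc m ≡⟨ sym (toℕ-next (suc i)) ⟩
    toℕ (next (suc i))        ≡⟨ cong toℕ next≡prev ⟩
    toℕ (inject₁ i)           ≡⟨ toℕ-inject₁ i ⟩
    toℕ i                     ∎))
  ... | inj₂ 2+i≡1+m = <⇒≢ 2≤m (trans (cong suc 0≡i) (suc-injective 2+i≡1+m))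
    where
    0≡i : 0 ≡ toℕ i
    0≡i = begin
      0                         ≡⟨ sym (n%n≡0 (suc m)) ⟩
      suc m % suc m             ≡⟨ cong (_% suc m) (sym 2+i≡1+m) ⟩
      suc (suc (toℕ i)) % suc m ≡⟨ sym (toℕ-next (suc i)) ⟩
      toℕ (next (suc i))        ≡⟨ cong toℕ next≡prev ⟩
      toℕ (inject₁ i)           ≡⟨ toℕ-inject₁ i ⟩
      toℕ i                     ∎

-- Subgraphs of the 5-gate

neighbours : Fin 13 → List (Fin 13)
neighbours 0F  = 2F ∷ 7F ∷ 11F ∷ []
neighbours 1F  = 2F ∷ 4F ∷ []
neighbours 2F  = 0F ∷ 1F ∷ 3F ∷ []
neighbours 3F  = 2F ∷ 4F ∷ 5F ∷ []
neighbours 4F  = 1F ∷ 3F ∷ 10F ∷ []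
neighbours 5F  = 3F ∷ 6F ∷ []
neighbours 6F  = 5F ∷ 7F ∷ 9F ∷ []
neighbours 7F  = 0F ∷ 6F ∷ 8F ∷ []
neighbours 8F  = 7F ∷ 9F ∷ []
neighbours 9F  = 6F ∷ 8F ∷ 12F ∷ []
neighbours 10F = 4F ∷ 11F ∷ []
neighbours 11F = 0F ∷ 10F ∷ 12F ∷ []
neighbours 12F = 9F ∷ 11F ∷ []

gateAdj? : ∀ i j → Dec (GateAdj i j)
gateAdj? i j = ((i , j) ∈ₑ? gateEdges) ⊎-dec ((j , i) ∈ₑ? gateEdges)
  where open import Data.List.Membership.DecPropositional (≡-dec (_≟_ {13}) (_≟_ {13}))
          using () renaming (_∈?_ to _∈ₑ?_)

neighbours-complete : ∀ i j → GateAdj i j → j ∈ neighbours i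
neighbours-complete = toWitness {a? = all? λ i → all? λ j → gateAdj? i j →-dec (j ∈? neighbours i)} _
  where open import Data.List.Membership.DecPropositional (_≟_ {13}) using (_∈?_)

neighbours-unique : ∀ i → Unique (neighbours i)
neighbours-unique = toWitness {a? = all? λ i → unique? (neighbours i)} _
  where open import Data.List.Relation.Unary.Unique.DecPropositional (_≟_ {13}) using (unique?)

Symmetric : (Fin 13 → Fin 13 → Bool) → Set
Symmetric L = ∀ i j → L i j ≡ L j i

degree : (Fin 13 → Fin 13 → Bool) → Fin 13 → ℕ
degree L i = count (L i) (neighbours i)

EndsOnlyAtAttachments : (Fin 13 → ℕ) → Set
EndsOnlyAtAttachments d = ∀ i → d i ≡ 2 ⊎ (T (isAttachment i) × d i ≡ 1)

ExactlyTwoEnds : (Fin 13 → ℕ) → Set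
ExactlyTwoEnds d = ∃₂ λ a b → a ≢ b × d a ≡ 1 × d b ≡ 1 × (∀ i → d i ≡ 1 → i ≡ a ⊎ i ≡ b)

endsOnlyAtAttachments-resp : ∀ {d d′} → d ≗ d′ → EndsOnlyAtAttachments d → EndsOnlyAtAttachments d′
endsOnlyAtAttachments-resp d≗d′ ends i =
  subst (λ n → n ≡ 2 ⊎ (T (isAttachment i) × n ≡ 1)) (d≗d′ i) (ends i)

exactlyTwoEnds-resp : ∀ {d d′} → d ≗ d′ → ExactlyTwoEnds d → ExactlyTwoEnds d′
exactlyTwoEnds-resp d≗d′ (a , b , a≢b , da≡1 , db≡1 , only) =
  a , b , a≢b , trans (sym (d≗d′ a)) da≡1 , trans (sym (d≗d′ b)) db≡1 ,
  λ i d′i≡1 → only i (trans (d≗d′ i) d′i≡1)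

endsOnlyAtAttachments? : ∀ d → Dec (EndsOnlyAtAttachments d)
endsOnlyAtAttachments? d = all? λ i → (d i ≟ℕ 2) ⊎-dec (T? (isAttachment i) ×-dec (d i ≟ℕ 1))

exactlyTwoEnds? : ∀ d → Dec (ExactlyTwoEnds d)
exactlyTwoEnds? d = any? λ a → any? λ b → ¬? (a ≟ b) ×-dec (d a ≟ℕ 1) ×-dec (d b ≟ℕ 1) ×-dec
  all? (λ i → (d i ≟ℕ 1) →-dec ((i ≟ a) ⊎-dec (i ≟ b)))

-- The 17 bits are the edges of gateEdges, in that order.
edgeBits : (Fin 13 → Fin 13 → Bool) → Vec Bool 17
edgeBits L =
  L 0F 2F ∷ L 0F 7F ∷ L 0F 11F ∷ L 1F 2F ∷ L 1F 4F ∷ L 2F 3F ∷ L 3F 4F ∷ L 3F 5F ∷ L 5F 6F ∷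
  L 6F 7F ∷ L 6F 9F ∷ L 7F 8F ∷ L 8F 9F ∷ L 9F 12F ∷ L 11F 12F ∷ L 10F 11F ∷ L 4F 10F ∷ []

fromEdgeBits : Vec Bool 17 → Fin 13 → Fin 13 → Bool
fromEdgeBits (x ∷ _) 0F 2F = x
fromEdgeBits (_ ∷ x ∷ _) 0F 7F = x
fromEdgeBits (_ ∷ _ ∷ x ∷ _) 0F 11F = x
fromEdgeBits (_ ∷ _ ∷ _ ∷ x ∷ _) 1F 2F = x
fromEdgeBits (_ ∷ _ ∷ _ ∷ _ ∷ x ∷ _) 1F 4F = x
fromEdgeBits (_ ∷ _ ∷ _ ∷ _ ∷ _ ∷ x ∷ _) 2F 3F = x
fromEdgeBits (_ ∷ _ ∷ _ ∷ _ ∷ _ ∷ _ ∷ x ∷ _) 3F 4F = x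
fromEdgeBits (_ ∷ _ ∷ _ ∷ _ ∷ _ ∷ _ ∷ _ ∷ x ∷ _) 3F 5F = x
fromEdgeBits (_ ∷ _ ∷ _ ∷ _ ∷ _ ∷ _ ∷ _ ∷ _ ∷ x ∷ _) 5F 6F = x
fromEdgeBits (_ ∷ _ ∷ _ ∷ _ ∷ _ ∷ _ ∷ _ ∷ _ ∷ _ ∷ x ∷ _) 6F 7F = x
fromEdgeBits (_ ∷ _ ∷ _ ∷ _ ∷ _ ∷ _ ∷ _ ∷ _ ∷ _ ∷ _ ∷ x ∷ _) 6F 9F = x
fromEdgeBits (_ ∷ _ ∷ _ ∷ _ ∷ _ ∷ _ ∷ _ ∷ _ ∷ _ ∷ _ ∷ _ ∷ x ∷ _) 7F 8F = x
fromEdgeBits (_ ∷ _ ∷ _ ∷ _ ∷ _ ∷ _ ∷ _ ∷ _ ∷ _ ∷ _ ∷ _ ∷ _ ∷ x ∷ _) 8F 9F = x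
fromEdgeBits (_ ∷ _ ∷ _ ∷ _ ∷ _ ∷ _ ∷ _ ∷ _ ∷ _ ∷ _ ∷ _ ∷ _ ∷ _ ∷ x ∷ _) 9F 12F = x
fromEdgeBits (_ ∷ _ ∷ _ ∷ _ ∷ _ ∷ _ ∷ _ ∷ _ ∷ _ ∷ _ ∷ _ ∷ _ ∷ _ ∷ _ ∷ x ∷ _) 11F 12F = x
fromEdgeBits (_ ∷ _ ∷ _ ∷ _ ∷ _ ∷ _ ∷ _ ∷ _ ∷ _ ∷ _ ∷ _ ∷ _ ∷ _ ∷ _ ∷ _ ∷ x ∷ _) 10F 11F = x
fromEdgeBits (_ ∷ _ ∷ _ ∷ _ ∷ _ ∷ _ ∷ _ ∷ _ ∷ _ ∷ _ ∷ _ ∷ _ ∷ _ ∷ _ ∷ _ ∷ _ ∷ x ∷ _) 4F 10F = x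
fromEdgeBits _ _ _ = false

orient : (Fin 13 → Fin 13 → Bool) → Fin 13 → Fin 13 → Bool
orient L i j = if toℕ i ≤ᵇ toℕ j then L i j else L j i

orient-sym : ∀ {L} → Symmetric L → ∀ i j → orient L i j ≡ L i j
orient-sym {L} sym-L i j with toℕ i ≤ᵇ toℕ j
... | true  = refl
... | false = sym-L j i

-- After orienting, degree only reads the relation at the 17 edges, oriented as in gateEdges.
degree-orient-edgeBits : ∀ L i → degree (orient L) i ≡ degree (orient (fromEdgeBits (edgeBits L))) i
degree-orient-edgeBits L 0F  = refl
degree-orient-edgeBits L 1F  = refl
degree-orient-edgeBits L 2F  = refl
degree-orient-edgeBits L 3F  = refl
degree-orient-edgeBits L 4F  = refl
degree-orient-edgeBits L 5F  = refl
degree-orient-edgeBits L 6F  = refl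
degree-orient-edgeBits L 7F  = refl
degree-orient-edgeBits L 8F  = refl
degree-orient-edgeBits L 9F  = refl
degree-orient-edgeBits L 10F = refl
degree-orient-edgeBits L 11F = refl
degree-orient-edgeBits L 12F = refl

ends⇒exactlyTwoEnds? : ∀ x → Dec (EndsOnlyAtAttachments (degree (orient (fromEdgeBits x))) →
                                  ExactlyTwoEnds (degree (orient (fromEdgeBits x))))
ends⇒exactlyTwoEnds? x = endsOnlyAtAttachments? (degree (orient (fromEdgeBits x))) →-dec
                         exactlyTwoEnds? (degree (orient (fromEdgeBits x)))

all-edgeSubsets : allᵇ 17 (λ x → does (ends⇒exactlyTwoEnds? x)) ≡ true
all-edgeSubsets = refl

edgeBits-exactlyTwoEnds : ∀ x → EndsOnlyAtAttachments (degree (orient (fromEdgeBits x))) →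
                          ExactlyTwoEnds (degree (orient (fromEdgeBits x)))
edgeBits-exactlyTwoEnds x = does-sound (ends⇒exactlyTwoEnds? x)
  (Equivalence.from T-≡ (allᵇ-sound (λ x → does (ends⇒exactlyTwoEnds? x)) all-edgeSubsets x))

gate-exactlyTwoEnds : ∀ L → Symmetric L → EndsOnlyAtAttachments (degree L) → ExactlyTwoEnds (degree L)
gate-exactlyTwoEnds L sym-L ends =
  exactlyTwoEnds-resp (sym ∘ degree≗)
    (edgeBits-exactlyTwoEnds (edgeBits L) (endsOnlyAtAttachments-resp degree≗ ends))
  where
  degree≗ : degree L ≗ degree (orient (fromEdgeBits (edgeBits L)))
  degree≗ i = trans (count-cong (λ j → sym (orient-sym sym-L i j)) (neighbours i))
                    (degree-orient-edgeBits L i)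

-- A Hamiltonian cycle through a copy of the 5-gate

module CycleThroughGate {m : ℕ} (G : SimpleGraph (suc m)) (f : Fin 13 → Fin (suc m))
                        (gate : GateCopy G f) (C : HamiltonianCycle G) where

  open GateCopy gate using (induced; attach; nonAttach) renaming (injective to f-injective)
  open HamiltonianCycle C using (three; injective; surjective; adjacent)
  open ≡-Reasoning

  pos : Fin (suc m) → Fin (suc m)
  pos v = proj₁ (surjective v)

  c-pos : ∀ v → c C (pos v) ≡ v
  c-pos v = proj₂ (surjective v) refl

  pos-c : ∀ p → pos (c C p) ≡ p
  pos-c p = injective (c-pos (c C p))

  succ pred : Fin (suc m) → Fin (suc m)
  succ v = c C (next (pos v))
  pred v = c C (prev (pos v))

  adj-succ : ∀ v → Adj G v (succ v)
  adj-succ v = subst (λ u → Adj G u (succ v)) (c-pos v) (adjacent (pos v))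

  adj-pred : ∀ v → Adj G v (pred v)
  adj-pred v = SimpleGraph.sym G
    (subst (Adj G (pred v)) (trans (cong (c C) (next-prev (pos v))) (c-pos v)) (adjacent (prev (pos v))))

  succ≢pred : ∀ v → succ v ≢ pred v
  succ≢pred v = next≢prev (s≤s⁻¹ three) (pos v) ∘ injective

  succ≡⇔pred≡ : ∀ {u w} → succ u ≡ w ⇔ pred w ≡ u
  succ≡⇔pred≡ {u} {w} = mk⇔ to from
    where
    to : succ u ≡ w → pred w ≡ u
    to refl = begin
      c C (prev (pos (c C (next (pos u))))) ≡⟨ cong (c C ∘ prev) (pos-c _) ⟩
      c C (prev (next (pos u)))             ≡⟨ cong (c C) (prev-next _) ⟩
      c C (pos u)                           ≡⟨ c-pos u ⟩
      u                                     ∎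
    from : pred w ≡ u → succ u ≡ w
    from refl = begin
      c C (next (pos (c C (prev (pos w))))) ≡⟨ cong (c C ∘ next) (pos-c _) ⟩
      c C (next (prev (pos w)))             ≡⟨ cong (c C) (next-prev _) ⟩
      c C (pos w)                           ≡⟨ c-pos w ⟩
      w                                     ∎

  consecutive : Fin (suc m) → Fin (suc m) → Bool
  consecutive u w = does (succ u ≟ w) ∨ does (pred u ≟ w)

  consecutive-sym : ∀ u w → consecutive u w ≡ consecutive w u
  consecutive-sym u w = begin
    does (succ u ≟ w) ∨ does (pred u ≟ w)
      ≡⟨ cong₂ _∨_ (does-⇔ succ≡⇔pred≡ (succ u ≟ w) (pred w ≟ u))
                   (does-⇔ (⇔-sym succ≡⇔pred≡) (pred u ≟ w) (succ w ≟ u)) ⟩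
    does (pred w ≟ u) ∨ does (succ w ≟ u)
      ≡⟨ ∨-comm (does (pred w ≟ u)) (does (succ w ≟ u)) ⟩
    does (succ w ≟ u) ∨ does (pred w ≟ u) ∎

  linked : Fin 13 → Fin 13 → Bool
  linked i j = consecutive (f i) (f j)

  insideNeighbours : Fin (suc m) → ℕ
  insideNeighbours v = count (inImage f) (succ v ∷ pred v ∷ [])

  inImage-⇔ : ∀ {v} → T (inImage f v) ⇔ ∃ λ i → f i ≡ v
  inImage-⇔ {v} = mk⇔
    (λ t → let i , t′ = Any.satisfied (any⁻ (λ j → does (f j ≟ v)) (allFin 13) t)
           in i , does-sound (f i ≟ v) t′)
    (λ (i , fi≡v) → any⁺ (λ j → does (f j ≟ v))
                         (Any.map (λ { refl → does-complete (f i ≟ v) fi≡v }) (∈-allFin i)))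

  inImage-preimage : ∀ {v} → inImage f v ≡ true → ∃ λ i → f i ≡ v
  inImage-preimage e = Equivalence.to inImage-⇔ (subst T (sym e) tt)

  inImage-image : ∀ i → inImage f (f i) ≡ true
  inImage-image i = Equivalence.to T-≡ (Equivalence.from inImage-⇔ (i , refl))

  inImage≡false⇒outside : ∀ {v} → inImage f v ≡ false → Outside f v
  inImage≡false⇒outside e i fi≡v = subst T e (Equivalence.from inImage-⇔ (i , fi≡v))

  outside⇒inImage≡false : ∀ {v} → Outside f v → inImage f v ≡ false
  outside⇒inImage≡false {v} out with inImage f v in e
  ... | false = refl
  ... | true  = let i , fi≡v = inImage-preimage e in ⊥-elim (out i fi≡v)

  count-neighbour-preimages : ∀ {i u} → Adj G (f i) u →
                   count (λ j → does (u ≟ f j)) (neighbours i) ≡ count (inImage f) (u ∷ [])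
  count-neighbour-preimages {i} {u} adj with inImage f u in e
  ... | false = count-none
    (All.universal (λ j t → inImage≡false⇒outside e j (sym (does-sound (u ≟ f j) t))) (neighbours i))
  ... | true with inImage-preimage e
  ...   | k , refl = begin
    count (λ j → does (f k ≟ f j)) (neighbours i)
      ≡⟨ count-cong (λ j → does-⇔ (mk⇔ (sym ∘ f-injective) (sym ∘ cong f)) (f k ≟ f j) (j ≟ k))
                    (neighbours i) ⟩
    count (λ j → does (j ≟ k)) (neighbours i)
      ≡⟨ count-≟-unique _≟_ (neighbours-unique i)
                        (neighbours-complete i k (Equivalence.to (induced i k) adj)) ⟩
    1 ∎

  degree-linked : ∀ i → degree linked i ≡ insideNeighbours (f i)
  degree-linked i = begin
    count (λ j → does (s ≟ f j) ∨ does (p ≟ f j)) (neighbours i)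
      ≡⟨ count-∨ (λ j s≡fj p≡fj → succ≢pred (f i)
                    (trans (does-sound (s ≟ f j) s≡fj) (sym (does-sound (p ≟ f j) p≡fj)))) (neighbours i) ⟩
    count (λ j → does (s ≟ f j)) (neighbours i) + count (λ j → does (p ≟ f j)) (neighbours i)
      ≡⟨ cong₂ _+_ (count-neighbour-preimages (adj-succ (f i)))
                   (count-neighbour-preimages (adj-pred (f i))) ⟩
    count (inImage f) (s ∷ []) + count (inImage f) (p ∷ [])
      ≡⟨ sym (count-++ (inImage f) (s ∷ []) (p ∷ [])) ⟩
    insideNeighbours (f i) ∎
    where
    s p : Fin (suc m)
    s = succ (f i)
    p = pred (f i)

  attachment-of-outside-neighbour : ∀ {i u} → Outside f u → Adj G (f i) u → T (isAttachment i)
  attachment-of-outside-neighbour {i} {u} out adj with T? (isAttachment i)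
  ... | yes att  = att
  ... | no ¬att = ⊥-elim (nonAttach i ¬att u out adj)

  -- Both would be the unique outside neighbour of f i.
  not-both-outside : ∀ i → Outside f (succ (f i)) → Outside f (pred (f i)) → ⊥
  not-both-outside i out-s out-p =
    let _ , _ , _ , unique = attach i (attachment-of-outside-neighbour out-s (adj-succ (f i)))
    in succ≢pred (f i) (trans (unique _ out-s (adj-succ (f i))) (sym (unique _ out-p (adj-pred (f i)))))

  pred-inside : ∀ i → inImage f (succ (f i)) ≡ false → inImage f (pred (f i)) ≡ true
  pred-inside i s with inImage f (pred (f i)) in p
  ... | true  = refl
  ... | false = ⊥-elim (not-both-outside i (inImage≡false⇒outside s) (inImage≡false⇒outside p))

  succ-inside : ∀ i → inImage f (pred (f i)) ≡ false → inImage f (succ (f i)) ≡ true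
  succ-inside i p with inImage f (succ (f i)) in s
  ... | true  = refl
  ... | false = ⊥-elim (not-both-outside i (inImage≡false⇒outside s) (inImage≡false⇒outside p))

  insideNeighbours-ends : EndsOnlyAtAttachments (insideNeighbours ∘ f)
  insideNeighbours-ends i with inImage f (succ (f i)) in s | inImage f (pred (f i)) in p
  ... | true  | true  = inj₁ refl
  ... | true  | false = inj₂ (attachment-of-outside-neighbour (inImage≡false⇒outside p) (adj-pred (f i)) , refl)
  ... | false | true  = inj₂ (attachment-of-outside-neighbour (inImage≡false⇒outside s) (adj-succ (f i)) , refl)
  ... | false | false = ⊥-elim (not-both-outside i (inImage≡false⇒outside s) (inImage≡false⇒outside p))

  exactlyTwoEnds : ExactlyTwoEnds (insideNeighbours ∘ f)
  exactlyTwoEnds = exactlyTwoEnds-resp degree-linked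
    (gate-exactlyTwoEnds linked (λ i j → consecutive-sym (f i) (f j))
      (endsOnlyAtAttachments-resp (sym ∘ degree-linked) insideNeighbours-ends))

  crossing : Fin (suc m) → Bool
  crossing p = inImage f (c C p) xor inImage f (c C (next p))

  -- The position on C of the edge by which C leaves or enters H at f i, when f i has one
  -- neighbour on C outside H.
  boundary : Fin 13 → Fin (suc m)
  boundary i = if inImage f (succ (f i)) then prev (pos (f i)) else pos (f i)

  BoundaryEdge : Fin 13 → Fin (suc m) → Set
  BoundaryEdge i p = (c C p ≡ f i × Outside f (c C (next p))) ⊎ (Outside f (c C p) × c C (next p) ≡ f i)

  boundaryEdge-crossing : ∀ {i p} → BoundaryEdge i p → T (crossing p)
  boundaryEdge-crossing {i} (inj₁ (e , out)) rewrite e | inImage-image i | outside⇒inImage≡false out = tt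
  boundaryEdge-crossing {i} (inj₂ (out , e)) rewrite e | inImage-image i | outside⇒inImage≡false out = tt

  boundary-edge : ∀ i → insideNeighbours (f i) ≡ 1 → BoundaryEdge i (boundary i)
  boundary-edge i one with inImage f (succ (f i)) in s | inImage f (pred (f i)) in p
  boundary-edge i () | true  | true
  boundary-edge i () | false | false
  ... | true  | false = inj₂ (inImage≡false⇒outside p , trans (cong (c C) (next-prev _)) (c-pos (f i)))
  ... | false | true  = inj₁ (c-pos (f i) , inImage≡false⇒outside s)

  boundary-injective : ∀ {a b} → insideNeighbours (f a) ≡ 1 → insideNeighbours (f b) ≡ 1 →
                       boundary a ≡ boundary b → a ≡ b
  boundary-injective {a} {b} a₁ b₁ eq with boundary-edge a a₁ | boundary-edge b b₁
  ... | inj₁ (ca , _)  | inj₁ (cb , _)  = f-injective (trans (sym ca) (trans (cong (c C) eq) cb))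
  ... | inj₁ (ca , _)  | inj₂ (out , _) = ⊥-elim (out a (trans (sym ca) (cong (c C) eq)))
  ... | inj₂ (out , _) | inj₁ (cb , _)  = ⊥-elim (out b (trans (sym cb) (cong (c C) (sym eq))))
  ... | inj₂ (_ , ca)  | inj₂ (_ , cb)  = f-injective (trans (sym ca) (trans (cong (c C ∘ next) eq) cb))

  pos-of : ∀ {i p} → c C p ≡ f i → pos (f i) ≡ p
  pos-of {p = p} cp≡fi = trans (cong pos (sym cp≡fi)) (pos-c p)

  exit-boundary : ∀ i {p} → c C p ≡ f i → inImage f (c C (next p)) ≡ false →
                  insideNeighbours (f i) ≡ 1 × p ≡ boundary i
  exit-boundary i {p} cp≡fi out =
    exit (trans (cong (λ q → inImage f (c C (next q))) (pos-of cp≡fi)) out)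
    where
    exit : inImage f (succ (f i)) ≡ false → insideNeighbours (f i) ≡ 1 × p ≡ boundary i
    exit s rewrite s | pred-inside i s = refl , sym (pos-of cp≡fi)

  entry-boundary : ∀ i {p} → c C (next p) ≡ f i → inImage f (c C p) ≡ false →
                   insideNeighbours (f i) ≡ 1 × p ≡ boundary i
  entry-boundary i {p} cnp≡fi out = entry (trans (cong (λ q → inImage f (c C q)) prev-pos≡p) out)
    where
    prev-pos≡p : prev (pos (f i)) ≡ p
    prev-pos≡p = trans (cong prev (pos-of cnp≡fi)) (prev-next p)
    entry : inImage f (pred (f i)) ≡ false → insideNeighbours (f i) ≡ 1 × p ≡ boundary i
    entry e rewrite succ-inside i e | e = refl , sym prev-pos≡p

  crossing-boundary : ∀ p → T (crossing p) → ∃ λ i → insideNeighbours (f i) ≡ 1 × p ≡ boundary i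
  crossing-boundary p t with inImage f (c C p) in e₁ | inImage f (c C (next p)) in e₂
  crossing-boundary p () | true  | true
  crossing-boundary p () | false | false
  ... | true  | false = let i , fi≡cp = inImage-preimage e₁ in i , exit-boundary i (sym fi≡cp) e₂
  ... | false | true  = let i , fi≡cnp = inImage-preimage e₂ in i , entry-boundary i (sym fi≡cnp) e₁

  crossing-count : count crossing (allFin (suc m)) ≡ 2
  crossing-count =
    let a , b , a≢b , a₁ , b₁ , only = exactlyTwoEnds
        crossing⇔ : ∀ p → T (crossing p) ⇔ (p ≡ boundary a ⊎ p ≡ boundary b)
        crossing⇔ p = mk⇔
          (λ t → let i , i₁ , p≡ = crossing-boundary p t in
                 map-⊎ (trans p≡ ∘ cong boundary) (trans p≡ ∘ cong boundary) (only i i₁))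
          (λ { (inj₁ refl) → boundaryEdge-crossing (boundary-edge a a₁)
             ; (inj₂ refl) → boundaryEdge-crossing (boundary-edge b b₁) })
    in count-≡2 _≟_ (allFin⁺ _) (∈-allFin _) (∈-allFin _)
                (a≢b ∘ boundary-injective a₁ b₁) crossing⇔

  externalEdgesUsed≡2 : externalEdgesUsed f C ≡ 2
  externalEdgesUsed≡2 = trans (length-filter crossing (allFin (suc m))) crossing-count

proposition3p4 : ∀ {n} (G : SimpleGraph n) (f : Fin 13 → Fin n) →
    GateCopy G f → (C : HamiltonianCycle G) → externalEdgesUsed f C ≡ 2
proposition3p4 {zero}  G f gate C with HamiltonianCycle.three C
... | ()
proposition3p4 {suc m} G f gate C = CycleThroughGate.externalEdgesUsed≡2 G f gate C
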